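{- Let $M$ be an infinite multipath of a stable MCS, written as a concatenation $M=M_1M_2\cdots$ of finite (non-empty) segments, and let $M'=(\overline{M_1})(\overline{M_2})\cdots$ be the infinite multipath whose $t$-th MC is the collapse $\overline{M_t}$. Then $M'$ satisfies Condition S if and only if $M$ does.
   Context: Fix variables $x_1,\dots,x_n$, primed copies $x_i'$. An MC is a conjunction of constraints $x\bowtie y$ ($x,y\in\{x_i,x_i'\}$, ${\bowtie}\in\{>,\ge,=\}$). An MCS: a finite directed multigraph on flow-points $F$ with arcs labelled by MCs ($G:f\to g$) and invariants $I_f$ (conjunctions of order constraints among $x_1,\dots,x_n$). A transition $(f,\sigma)\mapsto(g,\sigma')$ satisfies $G:f\to g$ if $\sigma\models I_f$, $\sigma'\models I_g$, $\sigma,\sigma'\models G$ ($\sigma,\sigma':\{1..n\}\to\mathbb Z$). $G\vdash P$: every transition satisfying $G$ satisfies $P$. MCs are graphs on nodes $x_i,x_i'$ (arc $x\to y$ strict for $x>y$, non-strict for $x\ge y$), identified with their consequence closures. Stable: every MC satisfiable, and for every $G:f\to g$, ${\rhd}\in\{>,\ge\}$: $G\vdash x_i\rhd x_j\Rightarrow I_f\vdash x_i\rhd x_j$ and $G\vdash x_i'\rhd x_j'\Rightarrow I_g\vdash x_i\rhd x_j$. The multipath of a CFG path $f_0\xrightarrow{G_1}f_1\cdots$ is the graph $G_1G_2\cdots$ with nodes $x[t,i]$ containing, for each $t\ge1$, the arcs of $G_t$ with $x_i\mapsto x[t-1,i]$, $x_j'\mapsto x[t,j]$; concatenation of multipaths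 follows concatenation of CFG paths. Composition $G_1;G_2$ of $G_1:f\to g$, $G_2:g\to h$ is the MC from $f$ to $h$ containing all constraints between $s,s'$ implied by the existence of $s''$ with $s\mapsto s''$ satisfying $G_1$ and $s''\mapsto s'$ satisfying $G_2$; the collapse $\overline{G_1\cdots G_\ell}$ is the consequence closure of $G_1;\cdots;G_\ell$. A down-thread: $(x[k,h_k])_{k\ge k_0}$ with arcs $x[k,h_k]\to x[k+1,h_{k+1}]$; up-thread: $(x[k,l_k])_{k\ge k_0}$ with arcs $x[k+1,l_{k+1}]\to x[k,l_k]$. An infinite multipath $M$ satisfies Condition S if it contains an infinite down-thread $(x[k,h_k])_{k\ge k_0}$ and an infinite up-thread $(x[k,l_k])_{k\ge k_0}$ such that the constraint $x[k,l_k]\le x[k,h_k]$ is present in $M$ for all $k\ge k_0$ and at least one of the two threads has infinitely many strict arcs. -}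

module Defs where

open import Data.Nat using (ℕ; zero; suc; _<_; _≤_)
open import Data.Integer as ℤ using (ℤ)
open import Data.Fin using (Fin)
open import Data.List using (List)
open import Data.List.Membership.Propositional using (_∈_)
open import Data.Product using (Σ; ∃; _×_; _,_)
open import Data.Sum using (_⊎_)
open import Relation.Binary.PropositionalEquality using (_≡_)

data Rel : Set where
  gt ge eq : Rel

data IsIneq : Rel → Set where
  isGt : IsIneq gt
  isGe : IsIneq ge

holdsRel : Rel → ℤ → ℤ → Set
holdsRel gt a b = b ℤ.< a
holdsRel ge a b = b ℤ.≤ a
holdsRel eq a b = a ≡ b

data Node (n : ℕ) : Set where
  unp : Fin n → Node n
  pri : Fin n → Node n

record Constraint (n : ℕ) : Set where
  constructor _⟨_⟩_
  field
    lhs : Node n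
    rel : Rel
    rhs : Node n

MC : ℕ → Set
MC n = List (Constraint n)

CSet : ℕ → Set₁
CSet n = Constraint n → Set

State : ℕ → Set
State n = Fin n → ℤ

val : ∀ {n} → State n → State n → Node n → ℤ
val σ σ' (unp i) = σ i
val σ σ' (pri i) = σ' i

satC : ∀ {n} → Constraint n → State n → State n → Set
satC (x ⟨ r ⟩ y) σ σ' = holdsRel r (val σ σ' x) (val σ σ' y)

record OrdConstraint (n : ℕ) : Set where
  constructor _⟪_⟫_
  field
    lhsI : Fin n
    relI : Rel
    rhsI : Fin n

Invariant : ℕ → Set
Invariant n = List (OrdConstraint n)

satO : ∀ {n} → OrdConstraint n → State n → Set
satO (i ⟪ r ⟫ j) σ = holdsRel r (σ i) (σ j)

satInv : ∀ {n} → Invariant n → State n → Set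
satInv I σ = ∀ c → c ∈ I → satO c σ

InvEntails : ∀ {n} → Invariant n → OrdConstraint n → Set
InvEntails I c = ∀ σ → satInv I σ → satO c σ

record MCS (n : ℕ) : Set where
  field
    nF    : ℕ                  -- number of flow-points (finite set Fin nF)
    nA    : ℕ                  -- number of arcs (finite multigraph)
    src   : Fin nA → Fin nF
    tgt   : Fin nA → Fin nF
    label : Fin nA → MC n
    inv   : Fin nF → Invariant n

module _ {n : ℕ} (S : MCS n) where
  open MCS S

  SatBy : Fin nF → Fin nF → CSet n → State n → State n → Set
  SatBy f g P σ σ' = satInv (inv f) σ × satInv (inv g) σ' × (∀ C → P C → satC C σ σ')

  Entails : Fin nF → Fin nF → CSet n → Constraint n → Set
  Entails f g P C = ∀ σ σ' → SatBy f g P σ σ' → satC C σ σ'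

  arcSet : Fin nA → CSet n
  arcSet a C = C ∈ label a

  ArcEntails : Fin nA → Constraint n → Set
  ArcEntails a C = Entails (src a) (tgt a) (arcSet a) C

  Stable : Set
  Stable =
      (∀ a → Σ (State n) λ σ → Σ (State n) λ σ' → SatBy (src a) (tgt a) (arcSet a) σ σ')
    × (∀ a i j r → IsIneq r → ArcEntails a (unp i ⟨ r ⟩ unp j) → InvEntails (inv (src a)) (i ⟪ r ⟫ j))
    × (∀ a i j r → IsIneq r → ArcEntails a (pri i ⟨ r ⟩ pri j) → InvEntails (inv (tgt a)) (i ⟪ r ⟫ j))

  -- an infinite CFG path  f₀ --G₁--> f₁ --G₂--> ⋯ ;  arc t carries G_{t+1}
  record InfPath : Set where
    field
      flow   : ℕ → Fin nF
      arc    : ℕ → Fin nA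
      src-ok : ∀ t → src (arc t) ≡ flow t
      tgt-ok : ∀ t → tgt (arc t) ≡ flow (suc t)

-- Infinite multipaths, abstractly: M t C  means that the constraint C
-- (x_i ↦ x[t,i], x_j' ↦ x[t+1,j]) belongs to (the consequence closure of)
-- the (t+1)-th MC of the multipath.

Multipath : ℕ → Set₁
Multipath n = ℕ → Constraint n → Set

module _ {n : ℕ} (M : Multipath n) where

  -- the constraint x[k,i] r x[k,j] is present in M
  -- (it can come from the MC leaving time k or from the MC entering time k)
  PresentAt : ℕ → Fin n → Rel → Fin n → Set
  PresentAt k i r j =
    M k (unp i ⟨ r ⟩ unp j) ⊎ (Σ ℕ λ k' → k ≡ suc k' × M k' (pri i ⟨ r ⟩ pri j))

  ConditionS : Set
  ConditionS =
    Σ ℕ λ k₀ → Σ (ℕ → Fin n) λ h → Σ (ℕ → Fin n) λ l →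
        (∀ k → k₀ ≤ k → M k (unp (h k) ⟨ ge ⟩ pri (h (suc k))))
      × (∀ k → k₀ ≤ k → M k (pri (l (suc k)) ⟨ ge ⟩ unp (l k)))
      × (∀ k → k₀ ≤ k → PresentAt k (h k) ge (l k))
      × ( (∀ m → Σ ℕ λ k → m ≤ k × k₀ ≤ k × M k (unp (h k) ⟨ gt ⟩ pri (h (suc k))))
        ⊎ (∀ m → Σ ℕ λ k → m ≤ k × k₀ ≤ k × M k (pri (l (suc k)) ⟨ gt ⟩ unp (l k))))

module _ {n : ℕ} (S : MCS n) (p : InfPath S) where
  open MCS S
  open InfPath p

  multipath : Multipath n
  multipath t C = ArcEntails S (arc t) C

  Step : ℕ → State n → State n → Set
  Step k σ σ' = SatBy S (flow k) (flow (suc k)) (arcSet S (arc k)) σ σ'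

  composition : ℕ → ℕ → CSet n
  composition i j C =
    ∀ (s : ℕ → State n) → (∀ k → i ≤ k → k < j → Step k (s k) (s (suc k))) → satC C (s i) (s j)

  -- segments M_{t+1} = arcs b t, …, b (t+1) - 1 ;  M' has as (t+1)-th MC the
  -- collapse (consequence closure of the composition) of M_{t+1}
  collapsedMultipath : (ℕ → ℕ) → Multipath n
  collapsedMultipath b t C = Entails S (flow (b t)) (flow (b (suc t))) (composition (b t) (b (suc t))) C

-- For a stable MCS, a finite stretch of a multipath implies a constraint x ⊳ y between two of its
-- variables exactly when the multipath graph (MC arcs plus invariants) has a path from x to y of
-- that strictness.  One direction is transitivity; for the other, if no such path exists, adding
-- the reverse arc creates no strict cycle, and counting predecessors in the resulting order gives
-- a run of the stretch violating x ⊳ y.  Stability straightens paths: a forward arc followed by a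
-- backward one is a constraint within one time, hence an invariant, so a path between different
-- times is a thread segment with the same strictness.
--
-- Hence every thread arc of a collapse M̄_t lifts to a thread segment through M_t, and the lifts
-- glue into threads of M, strict where the collapsed arcs are; conversely threads of M telescope
-- to threads of M'.  A present constraint x[k,l] ≤ x[k,h] is, by stability, an invariant at
-- time k, which transfers it in both directions.

module Submission where

open import Defs
open import Data.Nat using (ℕ; zero; suc; _+_; _∸_; _≤_; _<_; z≤n; s≤s; _≤?_; _<?_)
import Data.Nat.Properties as ℕP
open import Data.Integer as ℤ using (ℤ; +_)
import Data.Integer.Properties as ℤP
open import Data.Fin using (Fin; zero; suc; toℕ; fromℕ<)
import Data.Vec.Functional as Vector
open import Data.Fin.Properties using (all?; any?; toℕ-fromℕ<)
open import Data.List using (List; []; _∷_; _++_; map; length; allFin; upTo; cartesianProduct)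
open import Data.List.Membership.Propositional using (_∈_)
open import Data.List.Membership.Propositional.Properties
  using (∈-allFin; ∈-map⁺; ∈-++⁺ˡ; ∈-++⁺ʳ; ∈-upTo⁺; ∈-cartesianProduct⁺)
open import Data.List.Relation.Unary.Any using (here; there)
open import Data.Product using (Σ; _×_; _,_; proj₁; proj₂)
open import Data.Sum using (_⊎_; inj₁; inj₂)
import Data.Sum as Sum
open import Data.Empty using (⊥; ⊥-elim)
open import Function.Bundles using (_⇔_; mk⇔; Equivalence)
open import Relation.Nullary using (¬_; Dec; yes; no)
open import Relation.Nullary.Decidable using (_×-dec_; _→-dec_; _⊎-dec_)
import Relation.Nullary.Decidable as Dec
import Data.List.Relation.Unary.All as All
open import Function.Construct.Symmetry using (⇔-sym)
open import Function.Base using (_∘_)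
open import Relation.Unary using (Decidable)
open import Relation.Binary using (Tri; tri<; tri≈; tri>)
open import Relation.Binary.PropositionalEquality using (_≡_; _≢_; refl; sym; trans; cong; subst; subst₂)

count : {A : Set} {P : A → Set} → Decidable P → List A → ℕ
count P? [] = 0
count P? (x ∷ xs) with P? x
... | yes _ = suc (count P? xs)
... | no  _ = count P? xs

module _ {A : Set} where

  count≤length : {P : A → Set} (P? : Decidable P) → ∀ xs → count P? xs ≤ length xs
  count≤length P? [] = z≤n
  count≤length P? (x ∷ xs) with P? x
  ... | yes _ = s≤s (count≤length P? xs)
  ... | no  _ = ℕP.m≤n⇒m≤1+n (count≤length P? xs)

  module _ {P Q : A → Set} (P? : Decidable P) (Q? : Decidable Q) (P⇒Q : ∀ {x} → P x → Q x) where

    count-mono : ∀ xs → count P? xs ≤ count Q? xs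
    count-mono [] = z≤n
    count-mono (x ∷ xs) with P? x | Q? x
    ... | yes _ | yes _  = s≤s (count-mono xs)
    ... | yes p | no ¬q  = ⊥-elim (¬q (P⇒Q p))
    ... | no _  | yes _  = ℕP.m≤n⇒m≤1+n (count-mono xs)
    ... | no _  | no _   = count-mono xs

    count-mono-< : ∀ {y} xs → y ∈ xs → Q y → ¬ P y → count P? xs < count Q? xs
    count-mono-< (x ∷ xs) (here refl) qx ¬px with P? x | Q? x
    ... | yes px | _     = ⊥-elim (¬px px)
    ... | no _   | yes _ = s≤s (count-mono xs)
    ... | no _   | no ¬q = ⊥-elim (¬q qx)
    count-mono-< (x ∷ xs) (there y∈xs) qy ¬py with P? x | Q? x
    ... | yes _ | yes _  = s≤s (count-mono-< xs y∈xs qy ¬py)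
    ... | yes p | no ¬q  = ⊥-elim (¬q (P⇒Q p))
    ... | no _  | yes _  = ℕP.m≤n⇒m≤1+n (count-mono-< xs y∈xs qy ¬py)
    ... | no _  | no _   = count-mono-< xs y∈xs qy ¬py

∷-cong : ∀ {A : Set} {m} {x : A} {f g : Fin m → A} → (∀ i → f i ≡ g i) → ∀ i → (x Vector.∷ f) i ≡ (x Vector.∷ g) i
∷-cong f≗g zero    = refl
∷-cong f≗g (suc i) = f≗g i

all-functions? : ∀ {K} m (P : (Fin m → Fin K) → Set)
  → (∀ {f g} → (∀ i → f i ≡ g i) → P f → P g) → Decidable P → Dec (∀ f → P f)
all-functions? zero P resp P? = Dec.map′ (λ p f → resp (λ ()) p) (λ ∀P → ∀P _) (P? λ ())
all-functions? (suc m) P resp P? =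
  Dec.map′ (λ ∀P f → resp (λ { zero → refl ; (suc i) → refl }) (∀P (f zero) (λ i → f (suc i))))
           (λ ∀P x f → ∀P (x Vector.∷ f))
           (all? λ x → all-functions? m (λ f → P (x Vector.∷ f)) (λ f≗g → resp (∷-cong f≗g)) (λ f → P? (x Vector.∷ f)))

data Strictness : Set where
  weak strict : Strictness

infixr 6 _⊔_
_⊔_ : Strictness → Strictness → Strictness
weak   ⊔ g = g
strict ⊔ g = strict

⊔-identityʳ : ∀ f → f ⊔ weak ≡ f
⊔-identityʳ weak   = refl
⊔-identityʳ strict = refl

⊔-zeroʳ : ∀ f → f ⊔ strict ≡ strict
⊔-zeroʳ weak   = refl
⊔-zeroʳ strict = refl

⊔-assoc : ∀ f g h → (f ⊔ g) ⊔ h ≡ f ⊔ (g ⊔ h)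
⊔-assoc weak   g h = refl
⊔-assoc strict g h = refl

⊔-comm : ∀ f g → f ⊔ g ≡ g ⊔ f
⊔-comm weak   g = sym (⊔-identityʳ g)
⊔-comm strict g = sym (⊔-zeroʳ g)

⊔-strict : ∀ f g → f ⊔ g ≡ strict → f ≡ strict ⊎ g ≡ strict
⊔-strict strict g     _ = inj₁ refl
⊔-strict weak   _ g≡s = inj₂ g≡s

complement : Strictness → Strictness
complement weak   = strict
complement strict = weak

rel : Strictness → Rel
rel weak   = ge
rel strict = gt

rel-isIneq : ∀ f → IsIneq (rel f)
rel-isIneq weak   = isGe
rel-isIneq strict = isGt

holds-trans : ∀ f g {a b c} → holdsRel (rel f) a b → holdsRel (rel g) b c → holdsRel (rel (f ⊔ g)) a c
holds-trans weak   weak   a≥b b≥c = ℤP.≤-trans b≥c a≥b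
holds-trans weak   strict a≥b b>c = ℤP.<-≤-trans b>c a≥b
holds-trans strict weak   a>b b≥c = ℤP.≤-<-trans b≥c a>b
holds-trans strict strict a>b b>c = ℤP.<-trans b>c a>b

holds-weaken : ∀ f {a b} → holdsRel (rel f) a b → holdsRel ge a b
holds-weaken weak   a≥b = a≥b
holds-weaken strict a>b = ℤP.<⇒≤ a>b

infix 4 _≟ˢ_
_≟ˢ_ : (f g : Strictness) → Dec (f ≡ g)
weak   ≟ˢ weak   = yes refl
weak   ≟ˢ strict = no λ ()
strict ≟ˢ weak   = no λ ()
strict ≟ˢ strict = yes refl

any-strictness? : {P : Strictness → Set} → Decidable P → Dec (Σ Strictness P)
any-strictness? P? with P? weak | P? strict
... | yes p | _     = yes (weak , p)
... | _     | yes p = yes (strict , p)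
... | no ¬p | no ¬q = no λ { (weak , p) → ¬p p ; (strict , q) → ¬q q }

data Direction : Set where
  down up : Direction

oriented : Direction → {A : Set} → (A → A → Set) → A → A → Set
oriented down R x y = R x y
oriented up   R x y = R y x

oriented-trans : ∀ d {A : Set} (R : Strictness → A → A → Set)
  → (∀ {f g x y z} → R f x y → R g y z → R (f ⊔ g) x z)
  → ∀ {f g x y z} → oriented d (R f) x y → oriented d (R g) y z → oriented d (R (f ⊔ g)) x z
oriented-trans down R R-trans xy yz = R-trans xy yz
oriented-trans up   R R-trans {f} {g} yx zy = subst (λ h → R h _ _) (⊔-comm g f) (R-trans zy yx)

oriented-refl : ∀ d {A : Set} {R : A → A → Set} → (∀ {x} → R x x) → ∀ {x} → oriented d R x x
oriented-refl down R-refl = R-refl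
oriented-refl up   R-refl = R-refl

oriented? : ∀ d {A : Set} {R : A → A → Set} → (∀ x y → Dec (R x y)) → ∀ x y → Dec (oriented d R x y)
oriented? down R? x y = R? x y
oriented? up   R? x y = R? y x

threadArc : ∀ {n} → Direction → Strictness → Fin n → Fin n → Constraint n
threadArc down f i j = unp i ⟨ rel f ⟩ pri j
threadArc up   f i j = pri j ⟨ rel f ⟩ unp i

satC⇒oriented : ∀ {n} d {f} {i j : Fin n} {σ σ'} → satC (threadArc d f i j) σ σ'
  → oriented d (holdsRel (rel f)) (σ i) (σ' j)
satC⇒oriented down holds = holds
satC⇒oriented up   holds = holds

oriented⇒satC : ∀ {n} d {f} {i j : Fin n} {σ σ'} → oriented d (holdsRel (rel f)) (σ i) (σ' j)
  → satC (threadArc d f i j) σ σ'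
oriented⇒satC down holds = holds
oriented⇒satC up   holds = holds

module _ {n : ℕ} (M : Multipath n) where

  IsThread : Direction → ℕ → (ℕ → Fin n) → Set
  IsThread d k₀ h = ∀ k → k₀ ≤ k → M k (threadArc d weak (h k) (h (suc k)))

  InfinitelyStrict : Direction → ℕ → (ℕ → Fin n) → Set
  InfinitelyStrict d k₀ h = ∀ m → Σ ℕ λ k → m ≤ k × k₀ ≤ k × M k (threadArc d strict (h k) (h (suc k)))

module Telescope (R : Strictness → ℕ → ℕ → Set)
                 (R-refl : ∀ {i} → R weak i i)
                 (R-trans : ∀ {f g i j k} → R f i j → R g j k → R (f ⊔ g) i k) where

  telescope : ∀ {p q} → p ≤ q → (∀ k → p ≤ k → k < q → R weak k (suc k)) → R weak p q
  telescope {q = zero} z≤n steps = R-refl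
  telescope {p} {suc q} p≤1+q steps with ℕP.m≤n⇒m<n∨m≡n p≤1+q
  ... | inj₂ refl = R-refl
  ... | inj₁ p<1+q = R-trans (telescope (ℕP.≤-pred p<1+q) (λ k p≤k k<q → steps k p≤k (ℕP.m≤n⇒m≤1+n k<q)))
                             (steps q (ℕP.≤-pred p<1+q) ℕP.≤-refl)

  telescope-strict : ∀ {p q} → (∀ k → p ≤ k → k < q → R weak k (suc k))
    → ∀ k → p ≤ k → k < q → R strict k (suc k) → R strict p q
  telescope-strict steps k p≤k k<q k>1+k =
    R-trans (telescope p≤k (λ j p≤j j<k → steps j p≤j (ℕP.<-trans j<k k<q)))
            (R-trans k>1+k (telescope k<q (λ j k<j j<q → steps j (ℕP.≤-trans p≤k (ℕP.<⇒≤ k<j)) j<q)))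

module CountingValuation {A : Set} (_≽_ _≻_ : A → A → Set)
  (_≽?_ : ∀ x y → Dec (x ≽ y)) (_≻?_ : ∀ x y → Dec (x ≻ y))
  (≻⇒≽ : ∀ {x y} → x ≻ y → x ≽ y)
  (≽-trans : ∀ {x y z} → x ≽ y → y ≽ z → x ≽ z)
  (≻-≽-trans : ∀ {x y z} → x ≻ y → y ≽ z → x ≻ z)
  (≽-≻-trans : ∀ {x y z} → x ≽ y → y ≻ z → x ≻ z)
  (≻-irrefl : ∀ {x} → ¬ x ≻ x)
  (universe : List A) where

  -- Strict predecessors are counted twice, which makes the value strictly monotone for ≻.
  value : A → ℕ
  value x = count (x ≽?_) universe + count (x ≻?_) universe

  value-mono : ∀ {x y} → x ≽ y → value y ≤ value x
  value-mono {x} {y} x≽y =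
    ℕP.+-mono-≤ (count-mono (y ≽?_) (x ≽?_) (≽-trans x≽y) universe)
                (count-mono (y ≻?_) (x ≻?_) (≽-≻-trans x≽y) universe)

  value-mono-strict : ∀ {x y} → x ≻ y → y ∈ universe → value y < value x
  value-mono-strict {x} {y} x≻y y∈universe =
    ℕP.+-mono-≤-< (count-mono (y ≽?_) (x ≽?_) (≽-trans (≻⇒≽ x≻y)) universe)
                  (count-mono-< (y ≻?_) (x ≻?_) (λ y≻z → ≻-≽-trans x≻y (≻⇒≽ y≻z)) universe y∈universe x≻y ≻-irrefl)

  value≤ : ∀ x → value x ≤ length universe + length universe
  value≤ x = ℕP.+-mono-≤ (count≤length (x ≽?_) universe) (count≤length (x ≻?_) universe)

module _ {A : Set} (V : A → ℤ) (W : A → ℕ)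
         (mono : ∀ {x y} → V x ℤ.≤ V y → W x ≤ W y)
         (mono-< : ∀ {x y} → V x ℤ.< V y → W x < W y) where

  holdsRel-transfer : ∀ r x y → holdsRel r (V x) (V y) ⇔ holdsRel r (+ W x) (+ W y)
  holdsRel-transfer gt x y = mk⇔
    (λ Vy<Vx → ℤ.+<+ (mono-< Vy<Vx))
    (λ Wy<Wx → ℤP.≰⇒> (λ Vx≤Vy → ℕP.<⇒≱ (ℤP.drop‿+<+ Wy<Wx) (mono Vx≤Vy)))
  holdsRel-transfer ge x y = mk⇔
    (λ Vy≤Vx → ℤ.+≤+ (mono Vy≤Vx))
    (λ Wy≤Wx → ℤP.≮⇒≥ (λ Vx<Vy → ℕP.<⇒≱ (mono-< Vx<Vy) (ℤP.drop‿+≤+ Wy≤Wx)))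
  holdsRel-transfer eq x y = mk⇔
    (λ Vx≡Vy → cong +_ (ℕP.≤-antisym (mono (ℤP.≤-reflexive Vx≡Vy)) (mono (ℤP.≤-reflexive (sym Vx≡Vy)))))
    (λ Wx≡Wy → from (ℤP.<-cmp (V x) (V y)) (ℤP.+-injective Wx≡Wy))
    where
      from : Tri (V x ℤ.< V y) (V x ≡ V y) (V y ℤ.< V x) → W x ≡ W y → V x ≡ V y
      from (tri< Vx<Vy _ _) Wx≡Wy = ⊥-elim (ℕP.<⇒≢ (mono-< Vx<Vy) Wx≡Wy)
      from (tri≈ _ Vx≡Vy _) _     = Vx≡Vy
      from (tri> _ _ Vy<Vx) Wx≡Wy = ⊥-elim (ℕP.<⇒≢ (mono-< Vy<Vx) (sym Wx≡Wy))

-- Deciding entailment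

all-∈? : {A : Set} {P : A → Set} → Decidable P → ∀ xs → Dec (∀ x → x ∈ xs → P x)
all-∈? P? xs = Dec.map′ (λ ps x x∈xs → All.lookup ps x∈xs) (λ ps → All.tabulate (λ {x} → ps x)) (All.all? P? xs)

holdsRel? : ∀ r a b → Dec (holdsRel r a b)
holdsRel? gt a b = b ℤP.<? a
holdsRel? ge a b = b ℤP.≤? a
holdsRel? eq a b = a ℤP.≟ b

module _ {n : ℕ} where

  satC? : ∀ C (σ σ' : State n) → Dec (satC C σ σ')
  satC? (x ⟨ r ⟩ y) σ σ' = holdsRel? r (val σ σ' x) (val σ σ' y)

  satInv? : ∀ I (σ : State n) → Dec (satInv I σ)
  satInv? I σ = all-∈? (λ { (i ⟪ r ⟫ j) → holdsRel? r (σ i) (σ j) }) I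

  MCEntailsAt : Invariant n → Invariant n → MC n → Constraint n → State n → State n → Set
  MCEntailsAt I J G C σ σ' = satInv I σ × satInv J σ' × (∀ C' → C' ∈ G → satC C' σ σ') → satC C σ σ'

  MCEntails : Invariant n → Invariant n → MC n → Constraint n → Set
  MCEntails I J G C = ∀ σ σ' → MCEntailsAt I J G C σ σ'

  mcEntailsAt? : ∀ I J G C σ σ' → Dec (MCEntailsAt I J G C σ σ')
  mcEntailsAt? I J G C σ σ' =
    (satInv? I σ ×-dec satInv? J σ' ×-dec all-∈? (λ C' → satC? C' σ σ') G) →-dec satC? C σ σ'

  OrderEquivalent : (Node n → ℤ) → (Node n → ℤ) → Set
  OrderEquivalent V W = ∀ r x y → holdsRel r (V x) (V y) ⇔ holdsRel r (W x) (W y)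

  ≗⇒orderEquivalent : ∀ {V W} → (∀ x → V x ≡ W x) → OrderEquivalent V W
  ≗⇒orderEquivalent V≗W r x y = subst₂ (λ a b → _ ⇔ holdsRel r a b) (V≗W x) (V≗W y) (mk⇔ (λ h → h) (λ h → h))

  orderEquivalent-sym : ∀ {V W} → OrderEquivalent V W → OrderEquivalent W V
  orderEquivalent-sym V≈W r x y = ⇔-sym (V≈W r x y)

  module _ {σ σ' τ τ' : State n} (σ≈τ : OrderEquivalent (val σ σ') (val τ τ')) where

    satC-transfer : ∀ C → satC C σ σ' → satC C τ τ'
    satC-transfer (x ⟨ r ⟩ y) = Equivalence.to (σ≈τ r x y)

    satInv-transferˡ : ∀ I → satInv I σ → satInv I τ
    satInv-transferˡ I σ✓ (i ⟪ r ⟫ j) c∈I = Equivalence.to (σ≈τ r (unp i) (unp j)) (σ✓ _ c∈I)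

    satInv-transferʳ : ∀ I → satInv I σ' → satInv I τ'
    satInv-transferʳ I σ'✓ (i ⟪ r ⟫ j) c∈I = Equivalence.to (σ≈τ r (pri i) (pri j)) (σ'✓ _ c∈I)

  mcEntailsAt-transfer : ∀ {σ σ' τ τ'} I J G C → OrderEquivalent (val σ σ') (val τ τ')
    → MCEntailsAt I J G C σ σ' → MCEntailsAt I J G C τ τ'
  mcEntailsAt-transfer I J G C σ≈τ ent (I✓ , J✓ , G✓) =
    satC-transfer σ≈τ C (ent ( satInv-transferˡ τ≈σ I I✓ , satInv-transferʳ τ≈σ J J✓
                             , λ C' C'∈G → satC-transfer τ≈σ C' (G✓ C' C'∈G)))
    where τ≈σ = orderEquivalent-sym σ≈τ

  allNodes : List (Node n)
  allNodes = map unp (allFin n) ++ map pri (allFin n)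

  ∈-allNodes : ∀ x → x ∈ allNodes
  ∈-allNodes (unp i) = ∈-++⁺ˡ (∈-map⁺ unp (∈-allFin i))
  ∈-allNodes (pri i) = ∈-++⁺ʳ (map unp (allFin n)) (∈-map⁺ pri (∈-allFin i))

  rankBound : ℕ
  rankBound = suc (length allNodes + length allNodes)

  embed : (Fin n → Fin rankBound) → State n
  embed f i = + toℕ (f i)

  -- Entailment only sees the relative order of the 2n values, so states with small values suffice.
  compress : ∀ σ σ' → Σ (Fin n → Fin rankBound) λ f → Σ (Fin n → Fin rankBound) λ f' →
             OrderEquivalent (val σ σ') (val (embed f) (embed f'))
  compress σ σ' = rank ∘ unp , rank ∘ pri , λ r x y →
    subst₂ (λ a b → holdsRel r (V x) (V y) ⇔ holdsRel r a b) (sym (val-rank x)) (sym (val-rank y))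
      (holdsRel-transfer V value (λ {x} {y} → value-mono {y} {x})
                         (λ {x} {y} Vx<Vy → value-mono-strict {y} {x} Vx<Vy (∈-allNodes x)) r x y)
    where
      V = val σ σ'
      open CountingValuation (λ x y → V y ℤ.≤ V x) (λ x y → V y ℤ.< V x)
             (λ x y → V y ℤP.≤? V x) (λ x y → V y ℤP.<? V x) ℤP.<⇒≤
             (λ x≽y y≽z → ℤP.≤-trans y≽z x≽y) (λ x≻y y≽z → ℤP.≤-<-trans y≽z x≻y)
             (λ x≽y y≻z → ℤP.<-≤-trans y≻z x≽y) (ℤP.<-irrefl refl) allNodes
      rank : Node n → Fin rankBound
      rank x = fromℕ< (s≤s (value≤ x))
      val-rank : ∀ x → val (embed (rank ∘ unp)) (embed (rank ∘ pri)) x ≡ + value x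
      val-rank (unp i) = cong +_ (toℕ-fromℕ< _)
      val-rank (pri i) = cong +_ (toℕ-fromℕ< _)

  embed-congˡ : ∀ {f g f'} → (∀ i → f i ≡ g i) → OrderEquivalent (val (embed f) (embed f')) (val (embed g) (embed f'))
  embed-congˡ f≗g = ≗⇒orderEquivalent λ { (unp i) → cong (λ a → + toℕ a) (f≗g i) ; (pri i) → refl }

  embed-congʳ : ∀ {f f' g'} → (∀ i → f' i ≡ g' i)
    → OrderEquivalent (val (embed f) (embed f')) (val (embed f) (embed g'))
  embed-congʳ f'≗g' = ≗⇒orderEquivalent λ { (unp i) → refl ; (pri i) → cong (λ a → + toℕ a) (f'≗g' i) }

  mcEntails? : ∀ I J G C → Dec (MCEntails I J G C)
  mcEntails? I J G C =
    Dec.map′ (λ ∀ent σ σ' → let f , f' , σ≈ = compress σ σ' in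
                             mcEntailsAt-transfer I J G C (orderEquivalent-sym σ≈) (∀ent f f'))
             (λ ent f f' → ent (embed f) (embed f'))
             (all-functions? n (λ f → ∀ f' → MCEntailsAt I J G C (embed f) (embed f'))
                (λ f≗g ent f' → mcEntailsAt-transfer I J G C (embed-congˡ f≗g) (ent f'))
                (λ f → all-functions? n (λ f' → MCEntailsAt I J G C (embed f) (embed f'))
                         (λ f'≗g' → mcEntailsAt-transfer I J G C (embed-congʳ f'≗g'))
                         (λ f' → mcEntailsAt? I J G C (embed f) (embed f'))))

patch : {A : Set} → ℕ → (ℕ → A) → (ℕ → A) → ℕ → A
patch m g h k with k ≤? m
... | yes _ = g k
... | no  _ = h k

patch-≤ : ∀ {A : Set} m (g h : ℕ → A) {k} → k ≤ m → patch m g h k ≡ g k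
patch-≤ m g h {k} k≤m with k ≤? m
... | yes _   = refl
... | no  k≰m = ⊥-elim (k≰m k≤m)

patch-> : ∀ {A : Set} m (g h : ℕ → A) {k} → m < k → patch m g h k ≡ h k
patch-> m g h {k} m<k with k ≤? m
... | yes k≤m = ⊥-elim (ℕP.<⇒≱ m<k k≤m)
... | no  _   = refl

-- The multipath graph

module MultipathGraph {n : ℕ} (S : MCS n) (stable : Stable S) (P : InfPath S) where
  open MCS S
  open InfPath P

  record Step⊢ (k : ℕ) (C : Constraint n) : Set where
    constructor step⊢
    field entails : Entails S (flow k) (flow (suc k)) (arcSet S (arc k)) C

  record Inv⊢ (k : ℕ) (c : OrdConstraint n) : Set where
    constructor inv⊢
    field entails : InvEntails (inv (flow k)) c

  step⊢-weaken : ∀ {k x y} f → Step⊢ k (x ⟨ rel f ⟩ y) → Step⊢ k (x ⟨ ge ⟩ y)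
  step⊢-weaken f (step⊢ ⊢c) = step⊢ λ σ σ' step → holds-weaken f (⊢c σ σ' step)

  step⊢-trans : ∀ {k x y z} f g → Step⊢ k (x ⟨ rel f ⟩ y) → Step⊢ k (y ⟨ rel g ⟩ z) → Step⊢ k (x ⟨ rel (f ⊔ g) ⟩ z)
  step⊢-trans f g (step⊢ ⊢xy) (step⊢ ⊢yz) = step⊢ λ σ σ' step → holds-trans f g (⊢xy σ σ' step) (⊢yz σ σ' step)

  inv⊢-weaken : ∀ {k i j} f → Inv⊢ k (i ⟪ rel f ⟫ j) → Inv⊢ k (i ⟪ ge ⟫ j)
  inv⊢-weaken f (inv⊢ ⊢c) = inv⊢ λ σ σ✓ → holds-weaken f (⊢c σ σ✓)

  inv⊢-trans : ∀ {k i j l} f g → Inv⊢ k (i ⟪ rel f ⟫ j) → Inv⊢ k (j ⟪ rel g ⟫ l) → Inv⊢ k (i ⟪ rel (f ⊔ g) ⟫ l)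
  inv⊢-trans f g (inv⊢ ⊢ij) (inv⊢ ⊢jl) = inv⊢ λ σ σ✓ → holds-trans f g (⊢ij σ σ✓) (⊢jl σ σ✓)

  inv⊢-refl : ∀ {k i} → Inv⊢ k (i ⟪ ge ⟫ i)
  inv⊢-refl = inv⊢ λ σ σ✓ → ℤP.≤-refl

  inv⊢⇒step⊢ˡ : ∀ {k i j r} → Inv⊢ k (i ⟪ r ⟫ j) → Step⊢ k (unp i ⟨ r ⟩ unp j)
  inv⊢⇒step⊢ˡ (inv⊢ ⊢c) = step⊢ λ σ σ' (σ✓ , _ , _) → ⊢c σ σ✓

  inv⊢⇒step⊢ʳ : ∀ {k i j r} → Inv⊢ (suc k) (i ⟪ r ⟫ j) → Step⊢ k (pri i ⟨ r ⟩ pri j)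
  inv⊢⇒step⊢ʳ (inv⊢ ⊢c) = step⊢ λ σ σ' (_ , σ'✓ , _) → ⊢c σ' σ'✓

  step⊢⇒multipath : ∀ {k C} → Step⊢ k C → multipath S P k C
  step⊢⇒multipath {k} {C} (step⊢ ⊢C) =
    subst₂ (λ f g → Entails S f g (arcSet S (arc k)) C) (sym (src-ok k)) (sym (tgt-ok k)) ⊢C

  multipath⇒step⊢ : ∀ {k} C → multipath S P k C → Step⊢ k C
  multipath⇒step⊢ {k} C ⊢C = step⊢ (subst₂ (λ f g → Entails S f g (arcSet S (arc k)) C) (src-ok k) (tgt-ok k) ⊢C)

  step⊢⇒inv⊢ˡ : ∀ {k i j} f → Step⊢ k (unp i ⟨ rel f ⟩ unp j) → Inv⊢ k (i ⟪ rel f ⟫ j)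
  step⊢⇒inv⊢ˡ {k} {i} {j} f ⊢c = inv⊢ (subst (λ g → InvEntails (inv g) (i ⟪ rel f ⟫ j)) (src-ok k)
    (proj₁ (proj₂ stable) (arc k) i j (rel f) (rel-isIneq f) (step⊢⇒multipath ⊢c)))

  step⊢⇒inv⊢ʳ : ∀ {k i j} f → Step⊢ k (pri i ⟨ rel f ⟩ pri j) → Inv⊢ (suc k) (i ⟪ rel f ⟫ j)
  step⊢⇒inv⊢ʳ {k} {i} {j} f ⊢c = inv⊢ (subst (λ g → InvEntails (inv g) (i ⟪ rel f ⟫ j)) (tgt-ok k)
    (proj₂ (proj₂ stable) (arc k) i j (rel f) (rel-isIneq f) (step⊢⇒multipath ⊢c)))

  inv-satisfiable : ∀ k → Σ (State n) (satInv (inv (flow k)))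
  inv-satisfiable k with proj₁ stable (arc k)
  ... | σ , _ , σ✓ , _ = σ , subst (λ g → satInv (inv g) σ) (src-ok k) σ✓

  Point : Set
  Point = ℕ × Fin n

  data Edge : Strictness → Point → Point → Set where
    forward  : ∀ {f k i j} → Step⊢ k (unp i ⟨ rel f ⟩ pri j) → Edge f (k , i) (suc k , j)
    backward : ∀ {f k i j} → Step⊢ k (pri i ⟨ rel f ⟩ unp j) → Edge f (suc k , i) (k , j)
    level    : ∀ {f k i j} → Inv⊢ k (i ⟪ rel f ⟫ j) → Edge f (k , i) (k , j)

  infixl 5 _∷ʳ_
  data Path : Strictness → Point → Point → Set where
    []   : ∀ {x} → Path weak x x
    _∷ʳ_ : ∀ {f g x y z} → Path f x y → Edge g y z → Path (f ⊔ g) x z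

  edge-weaken : ∀ {f x y} → Edge f x y → Edge weak x y
  edge-weaken {f} (forward ⊢c)  = forward (step⊢-weaken f ⊢c)
  edge-weaken {f} (backward ⊢c) = backward (step⊢-weaken f ⊢c)
  edge-weaken {f} (level ⊢c)    = level (inv⊢-weaken f ⊢c)

  path-weaken : ∀ {f x y} → Path f x y → Path weak x y
  path-weaken []        = []
  path-weaken (π ∷ʳ e) = path-weaken π ∷ʳ edge-weaken e

  infixr 5 _++ᵖ_
  _++ᵖ_ : ∀ {f g x y z} → Path f x y → Path g y z → Path (f ⊔ g) x z
  _++ᵖ_ {f} π [] = subst (λ h → Path h _ _) (sym (⊔-identityʳ f)) π
  _++ᵖ_ {f} π (_∷ʳ_ {g} {h} ρ e) = subst (λ u → Path u _ _) (⊔-assoc f g h) ((π ++ᵖ ρ) ∷ʳ e)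

  infixl 5 _⇒_ _⇐_
  data ForwardChain : Strictness → Point → Point → Set where
    start : ∀ {f k i j} → Inv⊢ k (i ⟪ rel f ⟫ j) → ForwardChain f (k , i) (k , j)
    _⇒_   : ∀ {f g x m d j} → ForwardChain f x (m , d) → Step⊢ m (unp d ⟨ rel g ⟩ pri j)
          → ForwardChain (f ⊔ g) x (suc m , j)

  data BackwardChain : Strictness → Point → Point → Set where
    start : ∀ {f k i j} → Inv⊢ k (i ⟪ rel f ⟫ j) → BackwardChain f (k , i) (k , j)
    _⇐_   : ∀ {f g x m d j} → BackwardChain f x (suc m , d) → Step⊢ m (pri d ⟨ rel g ⟩ unp j)
          → BackwardChain (f ⊔ g) x (m , j)

  Chain : Strictness → Point → Point → Set
  Chain f x y = ForwardChain f x y ⊎ BackwardChain f x y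

  forwardChain-time : ∀ {f k i m j} → ForwardChain f (k , i) (m , j) → k ≤ m
  forwardChain-time (start _) = ℕP.≤-refl
  forwardChain-time (c ⇒ _)   = ℕP.m≤n⇒m≤1+n (forwardChain-time c)

  backwardChain-time : ∀ {f k i m j} → BackwardChain f (k , i) (m , j) → m ≤ k
  backwardChain-time (start _) = ℕP.≤-refl
  backwardChain-time (c ⇐ _)   = ℕP.≤-trans (ℕP.n≤1+n _) (backwardChain-time c)

  forwardChain-level : ∀ {f g x m d j} → ForwardChain f x (m , d) → Inv⊢ m (d ⟪ rel g ⟫ j)
    → ForwardChain (f ⊔ g) x (m , j)
  forwardChain-level {f} {g} (start ⊢c) ⊢c' = start (inv⊢-trans f g ⊢c ⊢c')
  forwardChain-level {g = g} (_⇒_ {f₁} {g₁} c ⊢c) ⊢c' =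
    subst (λ h → ForwardChain h _ _) (sym (⊔-assoc f₁ g₁ g)) (c ⇒ step⊢-trans g₁ g ⊢c (inv⊢⇒step⊢ʳ ⊢c'))

  backwardChain-level : ∀ {f g x m d j} → BackwardChain f x (m , d) → Inv⊢ m (d ⟪ rel g ⟫ j)
    → BackwardChain (f ⊔ g) x (m , j)
  backwardChain-level {f} {g} (start ⊢c) ⊢c' = start (inv⊢-trans f g ⊢c ⊢c')
  backwardChain-level {g = g} (_⇐_ {f₁} {g₁} c ⊢c) ⊢c' =
    subst (λ h → BackwardChain h _ _) (sym (⊔-assoc f₁ g₁ g)) (c ⇐ step⊢-trans g₁ g ⊢c (inv⊢⇒step⊢ˡ ⊢c'))

  -- A forward edge followed by a backward one (or vice versa) yields a constraint between two
  -- variables of one time, which stability turns into an invariant: paths never need to turn.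
  forwardChain-∷ʳ : ∀ {f g x y z} → ForwardChain f x y → Edge g y z → Chain (f ⊔ g) x z
  forwardChain-∷ʳ c (forward ⊢c) = inj₁ (c ⇒ ⊢c)
  forwardChain-∷ʳ c (level ⊢c)   = inj₁ (forwardChain-level c ⊢c)
  forwardChain-∷ʳ {f} {g} (start ⊢c) (backward ⊢c') =
    inj₂ (start inv⊢-refl ⇐ step⊢-trans f g (inv⊢⇒step⊢ʳ ⊢c) ⊢c')
  forwardChain-∷ʳ {g = g} (_⇒_ {f₁} {g₁} c ⊢c) (backward ⊢c') =
    inj₁ (subst (λ h → ForwardChain h _ _) (sym (⊔-assoc f₁ g₁ g))
                (forwardChain-level c (step⊢⇒inv⊢ˡ (g₁ ⊔ g) (step⊢-trans g₁ g ⊢c ⊢c'))))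

  backwardChain-∷ʳ : ∀ {f g x y z} → BackwardChain f x y → Edge g y z → Chain (f ⊔ g) x z
  backwardChain-∷ʳ c (backward ⊢c) = inj₂ (c ⇐ ⊢c)
  backwardChain-∷ʳ c (level ⊢c)    = inj₂ (backwardChain-level c ⊢c)
  backwardChain-∷ʳ {f} {g} (start ⊢c) (forward ⊢c') =
    inj₁ (start inv⊢-refl ⇒ step⊢-trans f g (inv⊢⇒step⊢ˡ ⊢c) ⊢c')
  backwardChain-∷ʳ {g = g} (_⇐_ {f₁} {g₁} c ⊢c) (forward ⊢c') =
    inj₂ (subst (λ h → BackwardChain h _ _) (sym (⊔-assoc f₁ g₁ g))
                (backwardChain-level c (step⊢⇒inv⊢ʳ (g₁ ⊔ g) (step⊢-trans g₁ g ⊢c ⊢c'))))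

  path⇒chain : ∀ {f x y} → Path f x y → Chain f x y
  path⇒chain []       = inj₁ (start inv⊢-refl)
  path⇒chain (π ∷ʳ e) = Sum.[ (λ c → forwardChain-∷ʳ c e) , (λ c → backwardChain-∷ʳ c e) ] (path⇒chain π)

  forwardChain⇒path : ∀ {f x y} → ForwardChain f x y → Path f x y
  forwardChain⇒path (start ⊢c) = [] ∷ʳ level ⊢c
  forwardChain⇒path (c ⇒ ⊢c)   = forwardChain⇒path c ∷ʳ forward ⊢c

  backwardChain⇒path : ∀ {f x y} → BackwardChain f x y → Path f x y
  backwardChain⇒path (start ⊢c) = [] ∷ʳ level ⊢c
  backwardChain⇒path (c ⇐ ⊢c)   = backwardChain⇒path c ∷ʳ backward ⊢c

  chain⇒path : ∀ {f x y} → Chain f x y → Path f x y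
  chain⇒path = Sum.[ forwardChain⇒path , backwardChain⇒path ]

  level-path⇒inv⊢ : ∀ {f k i j} → Path f (k , i) (k , j) → Inv⊢ k (i ⟪ rel f ⟫ j)
  level-path⇒inv⊢ π with path⇒chain π
  ... | inj₁ (start ⊢c) = ⊢c
  ... | inj₁ (c ⇒ _)    = ⊥-elim (ℕP.<-irrefl refl (forwardChain-time c))
  ... | inj₂ (start ⊢c) = ⊢c
  ... | inj₂ (c ⇐ _)    = ⊥-elim (ℕP.<-irrefl refl (backwardChain-time c))

  no-strict-cycle : ∀ x → ¬ Path strict x x
  no-strict-cycle (k , i) π = let σ , σ✓ = inv-satisfiable k in ℤP.<-irrefl refl (Inv⊢.entails (level-path⇒inv⊢ π) σ σ✓)

  step⊢? : ∀ k C → Dec (Step⊢ k C)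
  step⊢? k C = Dec.map′ step⊢ Step⊢.entails (mcEntails? (inv (flow k)) (inv (flow (suc k))) (label (arc k)) C)

  inv⊢? : ∀ k c → Dec (Inv⊢ k c)
  inv⊢? k (i ⟪ r ⟫ j) =
    Dec.map′ (λ ⊢c → inv⊢ λ σ σ✓ → ⊢c σ σ (σ✓ , (λ _ ()) , (λ _ ())))
             (λ ⊢c σ σ' (σ✓ , _) → Inv⊢.entails ⊢c σ σ✓)
             (mcEntails? (inv (flow k)) [] [] (unp i ⟨ r ⟩ unp j))

  ForwardLastStep : Strictness → Point → ℕ → Fin n → Set
  ForwardLastStep f x m j = Σ (Fin n) λ d → Σ Strictness λ f₁ → Σ Strictness λ g →
    (f₁ ⊔ g ≡ f) × ForwardChain f₁ x (m , d) × Step⊢ m (unp d ⟨ rel g ⟩ pri j)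

  BackwardLastStep : Strictness → Point → ℕ → Fin n → Set
  BackwardLastStep f x m j = Σ (Fin n) λ d → Σ Strictness λ f₁ → Σ Strictness λ g →
    (f₁ ⊔ g ≡ f) × BackwardChain f₁ x (suc m , d) × Step⊢ m (pri d ⟨ rel g ⟩ unp j)

  forwardChain-last : ∀ {f k i m j} → ForwardChain f (k , i) (suc m , j) → k ≢ suc m → ForwardLastStep f (k , i) m j
  forwardChain-last (start _) k≢k = ⊥-elim (k≢k refl)
  forwardChain-last (_⇒_ {f₁} {g} {d = d} c ⊢c) _ = d , f₁ , g , refl , c , ⊢c

  backwardChain-last : ∀ {f k i m j} → BackwardChain f (k , i) (m , j) → m < k → BackwardLastStep f (k , i) m j
  backwardChain-last (start _) k<k = ⊥-elim (ℕP.<-irrefl refl k<k)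
  backwardChain-last (_⇐_ {f₁} {g} {d = d} c ⊢c) _ = d , f₁ , g , refl , c , ⊢c

  forwardChain-to? : ∀ f k i m j → Dec (ForwardChain f (k , i) (m , j))
  forwardChain-to? f k i m j with k ℕP.≟ m
  forwardChain-to? f k i .k j | yes refl =
    Dec.map′ start (λ { (start ⊢c) → ⊢c ; (c ⇒ _) → ⊥-elim (ℕP.<-irrefl refl (forwardChain-time c)) })
             (inv⊢? k (i ⟪ rel f ⟫ j))
  forwardChain-to? f k i zero j | no k≢0 = no λ { (start _) → k≢0 refl }
  forwardChain-to? f k i (suc m) j | no k≢1+m =
    Dec.map′ (λ { (d , f₁ , g , refl , c , ⊢c) → c ⇒ ⊢c }) (λ c → forwardChain-last c k≢1+m)
      (any? λ d → any-strictness? λ f₁ → any-strictness? λ g →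
        (f₁ ⊔ g ≟ˢ f) ×-dec forwardChain-to? f₁ k i m d ×-dec step⊢? m (unp d ⟨ rel g ⟩ pri j))

  backwardChain-from? : ∀ δ f i m j → Dec (BackwardChain f (δ + m , i) (m , j))
  backwardChain-from? zero f i m j =
    Dec.map′ start (λ { (start ⊢c) → ⊢c ; (c ⇐ _) → ⊥-elim (ℕP.<-irrefl refl (backwardChain-time c)) })
             (inv⊢? m (i ⟪ rel f ⟫ j))
  backwardChain-from? (suc δ) f i m j =
    Dec.map′ (λ { (d , f₁ , g , refl , c , ⊢c) → c ⇐ ⊢c }) (λ c → backwardChain-last c (s≤s (ℕP.m≤n+m m δ)))
      (any? λ d → any-strictness? λ f₁ → any-strictness? λ g →
        (f₁ ⊔ g ≟ˢ f)
        ×-dec subst (λ k → Dec (BackwardChain f₁ (k , i) (suc m , d))) (ℕP.+-suc δ m)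
                    (backwardChain-from? δ f₁ i (suc m) d)
        ×-dec step⊢? m (pri d ⟨ rel g ⟩ unp j))

  backwardChain? : ∀ f x y → Dec (BackwardChain f x y)
  backwardChain? f (k , i) (m , j) with m ≤? k
  ... | yes m≤k = subst (λ k' → Dec (BackwardChain f (k' , i) (m , j))) (ℕP.m∸n+n≡m m≤k)
                        (backwardChain-from? (k ∸ m) f i m j)
  ... | no m≰k = no λ c → m≰k (backwardChain-time c)

  path? : ∀ f x y → Dec (Path f x y)
  path? f (k , i) (m , j) =
    Dec.map′ chain⇒path path⇒chain (forwardChain-to? f k i m j ⊎-dec backwardChain? f (k , i) (m , j))

  step⊢-eq⇒ge : ∀ {k x y} → Step⊢ k (x ⟨ eq ⟩ y) → Step⊢ k (x ⟨ ge ⟩ y) × Step⊢ k (y ⟨ ge ⟩ x)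
  step⊢-eq⇒ge (step⊢ ⊢c) = step⊢ (λ σ σ' step → ℤP.≤-reflexive (sym (⊢c σ σ' step)))
                         , step⊢ (λ σ σ' step → ℤP.≤-reflexive (⊢c σ σ' step))

  point : ℕ → Node n → Point
  point k (unp i) = k , i
  point k (pri i) = suc k , i

  step⊢⇒edge : ∀ {k} f x y → Step⊢ k (x ⟨ rel f ⟩ y) → Edge f (point k x) (point k y)
  step⊢⇒edge f (unp i) (unp j) ⊢c = level (step⊢⇒inv⊢ˡ f ⊢c)
  step⊢⇒edge f (unp i) (pri j) ⊢c = forward ⊢c
  step⊢⇒edge f (pri i) (unp j) ⊢c = backward ⊢c
  step⊢⇒edge f (pri i) (pri j) ⊢c = level (step⊢⇒inv⊢ʳ f ⊢c)

  -- Completeness of paths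

  Run : ℕ → (ℕ → State n) → Set
  Run q s = ∀ k → k < q → Step S P k (s k) (s (suc k))

  valueAt : (ℕ → State n) → Point → ℤ
  valueAt s (k , i) = s k i

  ValidUpTo : ℕ → Strictness → Point → Point → Set
  ValidUpTo q f x y = ∀ s → Run q s → holdsRel (rel f) (valueAt s x) (valueAt s y)

  pointsUpTo : ℕ → List Point
  pointsUpTo q = cartesianProduct (upTo (suc q)) (allFin n)

  ∈-pointsUpTo : ∀ {q k i} → k ≤ q → (k , i) ∈ pointsUpTo q
  ∈-pointsUpTo k≤q = ∈-cartesianProduct⁺ (∈-upTo⁺ (s≤s k≤q)) (∈-allFin _)

  -- Without an f-path x₀ → y₀, an arc y₀ → x₀ of the complementary strictness closes no strict
  -- cycle; counting predecessors in the extended order then gives a run violating x₀ ⊳ y₀.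
  module _ {x₀ y₀ : Point} where

    entry-strict : ∀ f f₁ f₂ → ¬ Path f x₀ y₀ → f₁ ⊔ complement f ⊔ f₂ ≡ strict → Path f₂ x₀ y₀ → f₁ ≡ strict
    entry-strict weak   f₁ f₂     ¬π _ π = ⊥-elim (¬π (path-weaken π))
    entry-strict strict f₁ strict ¬π _ π = ⊥-elim (¬π π)
    entry-strict strict f₁ weak   ¬π e π = trans (sym (⊔-identityʳ f₁)) e

    exit-strict : ∀ f f₁ f₂ → ¬ Path f x₀ y₀ → f₁ ⊔ complement f ⊔ f₂ ≡ strict → Path f₁ x₀ y₀ → f₂ ≡ strict
    exit-strict weak   f₁     f₂ ¬π _ π = ⊥-elim (¬π (path-weaken π))
    exit-strict strict strict f₂ ¬π _ π = ⊥-elim (¬π π)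
    exit-strict strict weak   f₂ ¬π e π = e

    no-strict-loop : ∀ f f₁ f₂ → ¬ Path f x₀ y₀ → f₁ ⊔ complement f ⊔ f₂ ≡ strict → ¬ Path (f₂ ⊔ f₁) x₀ y₀
    no-strict-loop weak   f₁     f₂     ¬π _  π = ¬π (path-weaken π)
    no-strict-loop strict weak   weak   ¬π () π
    no-strict-loop strict strict weak   ¬π _  π = ¬π π
    no-strict-loop strict f₁     strict ¬π _  π = ¬π π

  module Countermodel (q : ℕ) (f : Strictness) (x₀ y₀ : Point) (no-path : ¬ Path f x₀ y₀) where

    _≽_ _≻_ : Point → Point → Set
    x ≽ y = Path weak x y ⊎ (Path weak x y₀ × Path weak x₀ y)
    x ≻ y = Path strict x y
          ⊎ Σ Strictness λ f₁ → Σ Strictness λ f₂ → (f₁ ⊔ complement f ⊔ f₂ ≡ strict) × Path f₁ x y₀ × Path f₂ x₀ y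

    _≽?_ : ∀ x y → Dec (x ≽ y)
    x ≽? y = path? weak x y ⊎-dec (path? weak x y₀ ×-dec path? weak x₀ y)

    _≻?_ : ∀ x y → Dec (x ≻ y)
    x ≻? y = path? strict x y ⊎-dec any-strictness? λ f₁ → any-strictness? λ f₂ →
               (f₁ ⊔ complement f ⊔ f₂ ≟ˢ strict) ×-dec path? f₁ x y₀ ×-dec path? f₂ x₀ y

    ≻⇒≽ : ∀ {x y} → x ≻ y → x ≽ y
    ≻⇒≽ (inj₁ π)                  = inj₁ (path-weaken π)
    ≻⇒≽ (inj₂ (_ , _ , _ , π , ρ)) = inj₂ (path-weaken π , path-weaken ρ)

    ≽-trans : ∀ {x y z} → x ≽ y → y ≽ z → x ≽ z
    ≽-trans (inj₁ π)       (inj₁ ρ)       = inj₁ (π ++ᵖ ρ)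
    ≽-trans (inj₁ π)       (inj₂ (ρ , τ)) = inj₂ (π ++ᵖ ρ , τ)
    ≽-trans (inj₂ (π , τ)) (inj₁ ρ)       = inj₂ (π , τ ++ᵖ ρ)
    ≽-trans (inj₂ (π , _)) (inj₂ (_ , τ)) = inj₂ (π , τ)

    ≻-≽-trans : ∀ {x y z} → x ≻ y → y ≽ z → x ≻ z
    ≻-≽-trans (inj₁ π) (inj₁ ρ)       = inj₁ (π ++ᵖ ρ)
    ≻-≽-trans (inj₁ π) (inj₂ (ρ , τ)) = inj₂ (strict , weak , refl , π ++ᵖ ρ , τ)
    ≻-≽-trans (inj₂ (f₁ , f₂ , e , π , τ)) (inj₁ ρ) =
      inj₂ (f₁ , f₂ , e , π , subst (λ h → Path h _ _) (⊔-identityʳ f₂) (τ ++ᵖ ρ))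
    ≻-≽-trans (inj₂ (f₁ , f₂ , e , π , τ)) (inj₂ (ρ , τ'))
      with entry-strict f f₁ f₂ no-path e (subst (λ h → Path h _ _) (⊔-identityʳ f₂) (τ ++ᵖ ρ))
    ... | refl = inj₂ (strict , weak , refl , π , τ')

    ≽-≻-trans : ∀ {x y z} → x ≽ y → y ≻ z → x ≻ z
    ≽-≻-trans (inj₁ π)       (inj₁ ρ)                      = inj₁ (π ++ᵖ ρ)
    ≽-≻-trans (inj₁ π)       (inj₂ (f₁ , f₂ , e , ρ , τ)) = inj₂ (f₁ , f₂ , e , π ++ᵖ ρ , τ)
    ≽-≻-trans (inj₂ (π , τ)) (inj₁ ρ) = inj₂ (weak , strict , ⊔-zeroʳ (complement f) , π , τ ++ᵖ ρ)
    ≽-≻-trans (inj₂ (π , τ)) (inj₂ (f₁ , f₂ , e , ρ , τ')) with exit-strict f f₁ f₂ no-path e (τ ++ᵖ ρ)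
    ... | refl = inj₂ (weak , strict , ⊔-zeroʳ (complement f) , π , τ')

    ≻-irrefl : ∀ {x} → ¬ x ≻ x
    ≻-irrefl {x} (inj₁ π)                      = no-strict-cycle x π
    ≻-irrefl     (inj₂ (f₁ , f₂ , e , π , τ)) = no-strict-loop f f₁ f₂ no-path e (τ ++ᵖ π)

    open CountingValuation _≽_ _≻_ _≽?_ _≻?_ ≻⇒≽ ≽-trans ≻-≽-trans ≽-≻-trans ≻-irrefl (pointsUpTo q) public

    run : ℕ → State n
    run k i = + value (k , i)

    val-run : ∀ k x → val (run k) (run (suc k)) x ≡ + value (point k x)
    val-run k (unp i) = refl
    val-run k (pri i) = refl

    step⊢-holds : ∀ {k} r x y → proj₁ (point k y) ≤ q → Step⊢ k (x ⟨ r ⟩ y)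
      → holdsRel r (val (run k) (run (suc k)) x) (val (run k) (run (suc k)) y)
    step⊢-holds {k} r x y y≤q ⊢c rewrite val-run k x | val-run k y = holds r ⊢c
      where
        holds : ∀ r → Step⊢ k (x ⟨ r ⟩ y) → holdsRel r (+ value (point k x)) (+ value (point k y))
        holds gt ⊢c = ℤ.+<+ (value-mono-strict (inj₁ ([] ∷ʳ step⊢⇒edge strict x y ⊢c)) (∈-pointsUpTo y≤q))
        holds ge ⊢c = ℤ.+≤+ (value-mono (inj₁ ([] ∷ʳ step⊢⇒edge weak x y ⊢c)))
        holds eq ⊢c = let ⊢xy , ⊢yx = step⊢-eq⇒ge ⊢c in
          cong +_ (ℕP.≤-antisym (value-mono (inj₁ ([] ∷ʳ step⊢⇒edge weak y x ⊢yx)))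
                                (value-mono (inj₁ ([] ∷ʳ step⊢⇒edge weak x y ⊢xy))))

    inv-holds : ∀ k → k ≤ q → satInv (inv (flow k)) (run k)
    inv-holds k k≤q (i ⟪ r ⟫ j) c∈I = step⊢-holds r (unp i) (unp j) k≤q (inv⊢⇒step⊢ˡ (inv⊢ λ σ σ✓ → σ✓ _ c∈I))

    is-run : Run q run
    is-run k k<q = inv-holds k (ℕP.<⇒≤ k<q) , inv-holds (suc k) k<q , label-holds
      where
        label-holds : ∀ C → C ∈ label (arc k) → satC C (run k) (run (suc k))
        label-holds (x ⟨ r ⟩ y) C∈G = step⊢-holds r x y (point-bound y) (step⊢ λ σ σ' (_ , _ , G✓) → G✓ _ C∈G)
          where
            point-bound : ∀ z → proj₁ (point k z) ≤ q
            point-bound (unp _) = ℕP.<⇒≤ k<q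
            point-bound (pri _) = k<q

  valid⇒path : ∀ q f x y → proj₁ x ≤ q → ValidUpTo q f x y → Path f x y
  valid⇒path q f x@(_ , _) y@(_ , _) x≤q valid with path? f x y
  ... | yes π = π
  ... | no ¬π = ⊥-elim (refute f valid ¬π)
    where
      refute : ∀ f → ValidUpTo q f x y → ¬ Path f x y → ⊥
      refute weak valid ¬π = ℕP.<⇒≱ (value-mono-strict (inj₂ (weak , weak , refl , [] , [])) (∈-pointsUpTo x≤q))
                              (ℤP.drop‿+≤+ (valid run is-run))
        where open Countermodel q weak x y ¬π
      refute strict valid ¬π = ℕP.<⇒≱ (ℤP.drop‿+<+ (valid run is-run)) (value-mono (inj₂ ([] , [])))
        where open Countermodel q strict x y ¬π

  -- Thread segments

  -- A thread from x[p,a] to x[q,c]; only the values of thread on [p,q] matter.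
  record ThreadSegment (d : Direction) (f : Strictness) (p q : ℕ) (a c : Fin n) : Set where
    field
      thread       : ℕ → Fin n
      thread-start : thread p ≡ a
      thread-end   : thread q ≡ c
      arcs         : ∀ k → p ≤ k → k < q → Step⊢ k (threadArc d weak (thread k) (thread (suc k)))
      strict-arc   : f ≡ strict →
                     Σ ℕ λ k → p ≤ k × k < q × Step⊢ k (threadArc d strict (thread k) (thread (suc k)))

  threadArc-weaken : ∀ d f {k i j} → Step⊢ k (threadArc d f i j) → Step⊢ k (threadArc d weak i j)
  threadArc-weaken down f = step⊢-weaken f
  threadArc-weaken up   f = step⊢-weaken f

  arc-cong : ∀ {d f k u u' w w'} → u ≡ u' → w ≡ w'
    → Step⊢ k (threadArc d f u w) → Step⊢ k (threadArc d f u' w')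
  arc-cong {d} {f} {k} = subst₂ (λ u w → Step⊢ k (threadArc d f u w))

  trivial-segment : ∀ {d p a} → ThreadSegment d weak p p a a
  trivial-segment = record
    { thread = λ _ → _ ; thread-start = refl ; thread-end = refl
    ; arcs = λ k p≤k k<p → ⊥-elim (ℕP.<⇒≱ k<p p≤k) ; strict-arc = λ () }

  extendʳ : ∀ {d f g p m a e j} → ThreadSegment d f p m a e → p ≤ m → Step⊢ m (threadArc d g e j)
          → ThreadSegment d (f ⊔ g) p (suc m) a j
  extendʳ {d} {f} {g} {p} {m} {a} {e} {j} σ p≤m ⊢arc = record
    { thread       = t'
    ; thread-start = trans (patch-≤ m thread (λ _ → j) p≤m) thread-start
    ; thread-end   = patch-> m thread (λ _ → j) ℕP.≤-refl
    ; arcs         = arcs'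
    ; strict-arc   = λ f⊔g≡s → Sum.[ old-strict , (λ { refl → m , p≤m , ℕP.≤-refl , new-arc ⊢arc }) ] (⊔-strict f g f⊔g≡s)
    }
    where
      open ThreadSegment σ
      t' = patch m thread (λ _ → j)
      new-arc : ∀ {r} → Step⊢ m (threadArc d r e j) → Step⊢ m (threadArc d r (t' m) (t' (suc m)))
      new-arc = arc-cong (sym (trans (patch-≤ m thread (λ _ → j) ℕP.≤-refl) thread-end))
                         (sym (patch-> m thread (λ _ → j) ℕP.≤-refl))
      old-arc : ∀ {r k} → k < m → Step⊢ k (threadArc d r (thread k) (thread (suc k)))
        → Step⊢ k (threadArc d r (t' k) (t' (suc k)))
      old-arc k<m = arc-cong (sym (patch-≤ m thread (λ _ → j) (ℕP.<⇒≤ k<m))) (sym (patch-≤ m thread (λ _ → j) k<m))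
      arcs' : ∀ k → p ≤ k → k < suc m → Step⊢ k (threadArc d weak (t' k) (t' (suc k)))
      arcs' k p≤k k<1+m with ℕP.m≤n⇒m<n∨m≡n (ℕP.≤-pred k<1+m)
      ... | inj₁ k<m  = old-arc k<m (arcs k p≤k k<m)
      ... | inj₂ refl = new-arc (threadArc-weaken d g ⊢arc)
      old-strict : f ≡ strict → Σ ℕ λ k → p ≤ k × k < suc m × Step⊢ k (threadArc d strict (t' k) (t' (suc k)))
      old-strict f≡s = let k , p≤k , k<m , ⊢k = strict-arc f≡s in k , p≤k , ℕP.m≤n⇒m≤1+n k<m , old-arc k<m ⊢k

  extendˡ : ∀ {d f g m q e c j} → ThreadSegment d f (suc m) q e c → suc m ≤ q → Step⊢ m (threadArc d g j e)
          → ThreadSegment d (f ⊔ g) m q j c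
  extendˡ {d} {f} {g} {m} {q} {e} {c} {j} σ m<q ⊢arc = record
    { thread       = t'
    ; thread-start = patch-≤ m (λ _ → j) thread ℕP.≤-refl
    ; thread-end   = trans (patch-> m (λ _ → j) thread m<q) thread-end
    ; arcs         = arcs'
    ; strict-arc   = λ f⊔g≡s → Sum.[ old-strict , (λ { refl → m , ℕP.≤-refl , m<q , new-arc ⊢arc }) ] (⊔-strict f g f⊔g≡s)
    }
    where
      open ThreadSegment σ
      t' = patch m (λ _ → j) thread
      new-arc : ∀ {r} → Step⊢ m (threadArc d r j e) → Step⊢ m (threadArc d r (t' m) (t' (suc m)))
      new-arc = arc-cong (sym (patch-≤ m (λ _ → j) thread ℕP.≤-refl))
                         (sym (trans (patch-> m (λ _ → j) thread ℕP.≤-refl) thread-start))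
      old-arc : ∀ {r k} → m < k → Step⊢ k (threadArc d r (thread k) (thread (suc k)))
        → Step⊢ k (threadArc d r (t' k) (t' (suc k)))
      old-arc m<k = arc-cong (sym (patch-> m (λ _ → j) thread m<k)) (sym (patch-> m (λ _ → j) thread (ℕP.m≤n⇒m≤1+n m<k)))
      arcs' : ∀ k → m ≤ k → k < q → Step⊢ k (threadArc d weak (t' k) (t' (suc k)))
      arcs' k m≤k k<q with ℕP.m≤n⇒m<n∨m≡n m≤k
      ... | inj₁ m<k  = old-arc m<k (arcs k m<k k<q)
      ... | inj₂ refl = new-arc (threadArc-weaken d g ⊢arc)
      old-strict : f ≡ strict → Σ ℕ λ k → m ≤ k × k < q × Step⊢ k (threadArc d strict (t' k) (t' (suc k)))
      old-strict f≡s = let k , m<k , k<q , ⊢k = strict-arc f≡s in k , ℕP.<⇒≤ m<k , k<q , old-arc m<k ⊢k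

  forwardChain⇒segment : ∀ {f p a q c} → ForwardChain f (p , a) (q , c) → p < q → ThreadSegment down f p q a c
  forwardChain⇒segment (start _) p<p = ⊥-elim (ℕP.<-irrefl refl p<p)
  forwardChain⇒segment (_⇒_ {f₁} {g} (start ⊢c) ⊢c') _ =
    extendʳ trivial-segment ℕP.≤-refl (step⊢-trans f₁ g (inv⊢⇒step⊢ˡ ⊢c) ⊢c')
  forwardChain⇒segment (c@(c' ⇒ _) ⇒ ⊢c') _ =
    extendʳ (forwardChain⇒segment c (s≤s (forwardChain-time c'))) (ℕP.m≤n⇒m≤1+n (forwardChain-time c')) ⊢c'

  backwardChain⇒segment : ∀ {f p a q c} → BackwardChain f (q , c) (p , a) → p < q → ThreadSegment up f p q a c
  backwardChain⇒segment (start _) p<p = ⊥-elim (ℕP.<-irrefl refl p<p)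
  backwardChain⇒segment (_⇐_ {f₁} {g} (start ⊢c) ⊢c') _ =
    extendˡ trivial-segment ℕP.≤-refl (step⊢-trans f₁ g (inv⊢⇒step⊢ʳ ⊢c) ⊢c')
  backwardChain⇒segment (c@(c' ⇐ _) ⇐ ⊢c') _ =
    extendˡ (backwardChain⇒segment c (backwardChain-time c')) (ℕP.<⇒≤ (backwardChain-time c')) ⊢c'

  path⇒segment : ∀ d {f p a q c} → oriented d (Path f) (p , a) (q , c) → p < q → ThreadSegment d f p q a c
  path⇒segment down π p<q with path⇒chain π
  ... | inj₁ c = forwardChain⇒segment c p<q
  ... | inj₂ c = ⊥-elim (ℕP.<⇒≱ p<q (backwardChain-time c))
  path⇒segment up π p<q with path⇒chain π
  ... | inj₁ c = ⊥-elim (ℕP.<⇒≱ p<q (forwardChain-time c))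
  ... | inj₂ c = backwardChain⇒segment c p<q

  threadArc⇒path : ∀ d {f k i j} → Step⊢ k (threadArc d f i j) → oriented d (Path f) (k , i) (suc k , j)
  threadArc⇒path down ⊢c = [] ∷ʳ forward ⊢c
  threadArc⇒path up   ⊢c = [] ∷ʳ backward ⊢c

  segment⇒path : ∀ {d f p q a c} (σ : ThreadSegment d f p q a c) → ∀ {k} → p ≤ k → k ≤ q
               → oriented d (Path weak) (k , ThreadSegment.thread σ k) (q , c)
  segment⇒path {d} {q = q} σ {k} p≤k k≤q =
    subst (λ c → oriented d (Path weak) (k , thread k) (q , c)) thread-end
      (telescope k≤q λ j k≤j j<q → threadArc⇒path d (arcs j (ℕP.≤-trans p≤k k≤j) j<q))
    where
      open ThreadSegment σ
      open Telescope (λ g i j → oriented d (Path g) (i , thread i) (j , thread j))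
                     (oriented-refl d []) (oriented-trans d Path _++ᵖ_)

  ends : ℕ → ℕ → Node n → Point
  ends t u (unp i) = t , i
  ends t u (pri i) = u , i

  collapse⇒path : ∀ {t u} f x y → t < u
    → Entails S (flow t) (flow u) (composition S P t u) (x ⟨ rel f ⟩ y) → Path f (ends t u x) (ends t u y)
  collapse⇒path {t} {suc u} f x y t<u ⊢c = valid⇒path (suc u) f _ _ (ends-bound x) valid
    where
      ends-bound : ∀ z → proj₁ (ends t (suc u) z) ≤ suc u
      ends-bound (unp _) = ℕP.<⇒≤ t<u
      ends-bound (pri _) = ℕP.≤-refl
      val-ends : ∀ s z → val (s t) (s (suc u)) z ≡ valueAt s (ends t (suc u) z)
      val-ends s (unp i) = refl
      val-ends s (pri i) = refl
      valid : ValidUpTo (suc u) f (ends t (suc u) x) (ends t (suc u) y)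
      valid s run = subst₂ (holdsRel (rel f)) (val-ends s x) (val-ends s y)
        (⊢c (s t) (s (suc u)) ( proj₁ (run t t<u) , proj₁ (proj₂ (run u ℕP.≤-refl))
                               , λ C c → c s (λ k _ k<u → run k k<u)))

  collapse⇒threadPath : ∀ d {f t u i j} → t < u
    → Entails S (flow t) (flow u) (composition S P t u) (threadArc d f i j) → oriented d (Path f) (t , i) (u , j)
  collapse⇒threadPath down {f} {i = i} {j} = collapse⇒path f (unp i) (pri j)
  collapse⇒threadPath up   {f} {i = i} {j} = collapse⇒path f (pri j) (unp i)

-- Transfer of Condition S

module Segmentation (b : ℕ → ℕ) (b0≡0 : b 0 ≡ 0) (b-increasing : ∀ t → b t < b (suc t)) where

  b-mono : ∀ {t t'} → t ≤ t' → b t ≤ b t'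
  b-mono {t} {zero} z≤n = ℕP.≤-refl
  b-mono {t} {suc t'} t≤1+t' with ℕP.m≤n⇒m<n∨m≡n t≤1+t'
  ... | inj₂ refl = ℕP.≤-refl
  ... | inj₁ t<1+t' = ℕP.≤-trans (b-mono (ℕP.≤-pred t<1+t')) (ℕP.<⇒≤ (b-increasing t'))

  t≤b : ∀ t → t ≤ b t
  t≤b zero    = z≤n
  t≤b (suc t) = ℕP.≤-<-trans (t≤b t) (b-increasing t)

  segmentIndex : ℕ → ℕ
  segmentIndex zero = 0
  segmentIndex (suc k) with suc k <? b (suc (segmentIndex k))
  ... | yes _ = segmentIndex k
  ... | no  _ = suc (segmentIndex k)

  segmentIndex-bounds : ∀ k → b (segmentIndex k) ≤ k × k < b (suc (segmentIndex k))
  segmentIndex-bounds zero = subst (_≤ 0) (sym b0≡0) z≤n , subst (_< b 1) b0≡0 (b-increasing 0)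
  segmentIndex-bounds (suc k) with suc k <? b (suc (segmentIndex k))
  ... | yes 1+k<b = ℕP.m≤n⇒m≤1+n (proj₁ (segmentIndex-bounds k)) , 1+k<b
  ... | no  1+k≮b = ℕP.≮⇒≥ 1+k≮b , ℕP.≤-<-trans (proj₂ (segmentIndex-bounds k)) (b-increasing _)

  segmentIndex-unique : ∀ t k → b t ≤ k → k < b (suc t) → segmentIndex k ≡ t
  segmentIndex-unique t k b≤k k<b with ℕP.<-cmp (segmentIndex k) t
  ... | tri< s<t _ _ = ⊥-elim (ℕP.<⇒≱ (proj₂ (segmentIndex-bounds k)) (ℕP.≤-trans (b-mono s<t) b≤k))
  ... | tri≈ _ s≡t _ = s≡t
  ... | tri> _ _ t<s = ⊥-elim (ℕP.<⇒≱ k<b (ℕP.≤-trans (b-mono t<s) (proj₁ (segmentIndex-bounds k))))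

  segmentIndex-≥ : ∀ t k → b t ≤ k → t ≤ segmentIndex k
  segmentIndex-≥ t k b≤k = ℕP.≮⇒≥ λ s<t → ℕP.<⇒≱ (proj₂ (segmentIndex-bounds k)) (ℕP.≤-trans (b-mono s<t) b≤k)

module CollapseTheorem {n : ℕ} (S : MCS n) (stable : Stable S) (P : InfPath S)
                       (b : ℕ → ℕ) (b0≡0 : b 0 ≡ 0) (b-increasing : ∀ t → b t < b (suc t)) where
  open InfPath P
  open MultipathGraph S stable P
  open Segmentation b b0≡0 b-increasing

  M M' : Multipath n
  M  = multipath S P
  M' = collapsedMultipath S P b

  present⇒inv⊢ : ∀ {k i j} → PresentAt M k i ge j → Inv⊢ k (i ⟪ ge ⟫ j)
  present⇒inv⊢ (inj₁ ⊢c)              = step⊢⇒inv⊢ˡ weak (multipath⇒step⊢ _ ⊢c)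
  present⇒inv⊢ (inj₂ (_ , refl , ⊢c)) = step⊢⇒inv⊢ʳ weak (multipath⇒step⊢ _ ⊢c)

  inv⊢⇒present : ∀ {k i j} → Inv⊢ k (i ⟪ ge ⟫ j) → PresentAt M k i ge j
  inv⊢⇒present ⊢c = inj₁ (step⊢⇒multipath (inv⊢⇒step⊢ˡ ⊢c))

  composition⇒collapsed : ∀ {t} C → composition S P (b t) (b (suc t)) C → M' t C
  composition⇒collapsed C c σ σ' (_ , _ , comp✓) = comp✓ C c

  inv⊢⇒collapsed-present : ∀ {t i j} → Inv⊢ (b t) (i ⟪ ge ⟫ j) → PresentAt M' t i ge j
  inv⊢⇒collapsed-present {t} {i} {j} ⊢c =
    inj₁ (composition⇒collapsed (unp i ⟨ ge ⟩ unp j) λ s steps →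
            Inv⊢.entails ⊢c (s (b t)) (proj₁ (steps (b t) ℕP.≤-refl (b-increasing t))))

  collapsed-present⇒path : ∀ {t i j} → PresentAt M' t i ge j → Path weak (b t , i) (b t , j)
  collapsed-present⇒path {t} (inj₁ ⊢c)              = collapse⇒path weak (unp _) (unp _) (b-increasing t) ⊢c
  collapsed-present⇒path     (inj₂ (t , refl , ⊢c)) = collapse⇒path weak (pri _) (pri _) (b-increasing t) ⊢c

  module ThreadSemantics (d : Direction) {k₀ : ℕ} {h : ℕ → Fin n} (arcs : IsThread M d k₀ h)
                         {t : ℕ} (k₀≤t : k₀ ≤ t) (s : ℕ → State n)
                         (steps : ∀ k → b t ≤ k → k < b (suc t) → Step S P k (s k) (s (suc k))) where

    arc-holds : ∀ {f} k → b t ≤ k → k < b (suc t) → M k (threadArc d f (h k) (h (suc k)))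
              → oriented d (holdsRel (rel f)) (s k (h k)) (s (suc k) (h (suc k)))
    arc-holds {f} k bt≤k k<bt' ⊢c = satC⇒oriented d {σ = s k} {s (suc k)}
      (Step⊢.entails (multipath⇒step⊢ (threadArc d f (h k) (h (suc k))) ⊢c) (s k) (s (suc k)) (steps k bt≤k k<bt'))

    open Telescope (λ f i j → oriented d (holdsRel (rel f)) (s i (h i)) (s j (h j)))
                   (oriented-refl d ℤP.≤-refl) (oriented-trans d (λ f → holdsRel (rel f)) (holds-trans _ _))

    arcs-hold : ∀ k → b t ≤ k → k < b (suc t) → oriented d (holdsRel ge) (s k (h k)) (s (suc k) (h (suc k)))
    arcs-hold k bt≤k k<bt' = arc-holds k bt≤k k<bt' (arcs k (ℕP.≤-trans k₀≤t (ℕP.≤-trans (t≤b t) bt≤k)))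

    segment-holds : satC (threadArc d weak (h (b t)) (h (b (suc t)))) (s (b t)) (s (b (suc t)))
    segment-holds = oriented⇒satC d (telescope (ℕP.<⇒≤ (b-increasing t)) arcs-hold)

    segment-holds-strict : ∀ k → b t ≤ k → k < b (suc t) → M k (threadArc d strict (h k) (h (suc k)))
                         → satC (threadArc d strict (h (b t)) (h (b (suc t)))) (s (b t)) (s (b (suc t)))
    segment-holds-strict k bt≤k k<bt' ⊢k = oriented⇒satC d (telescope-strict arcs-hold k bt≤k k<bt' (arc-holds k bt≤k k<bt' ⊢k))

  thread⇒collapsed : ∀ d {k₀ h} → IsThread M d k₀ h → IsThread M' d k₀ (h ∘ b)
  thread⇒collapsed d {h = h} arcs t k₀≤t =
    composition⇒collapsed (threadArc d weak (h (b t)) (h (b (suc t)))) λ s steps →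
      ThreadSemantics.segment-holds d arcs k₀≤t s steps

  strict⇒collapsed : ∀ d {k₀ h} → IsThread M d k₀ h → InfinitelyStrict M d k₀ h → InfinitelyStrict M' d k₀ (h ∘ b)
  strict⇒collapsed d {k₀} {h} arcs strict-arcs m =
    let k , bm+bk₀≤k , _ , ⊢k = strict-arcs (b m + b k₀)
        bt≤k , k<bt' = segmentIndex-bounds k
        k₀≤t = segmentIndex-≥ k₀ k (ℕP.≤-trans (ℕP.m≤n+m (b k₀) (b m)) bm+bk₀≤k)
    in segmentIndex k , segmentIndex-≥ m k (ℕP.≤-trans (ℕP.m≤m+n (b m) (b k₀)) bm+bk₀≤k) , k₀≤t ,
       composition⇒collapsed (threadArc d strict (h (b (segmentIndex k))) (h (b (suc (segmentIndex k))))) λ s steps →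
         ThreadSemantics.segment-holds-strict d arcs k₀≤t s steps k bt≤k k<bt' ⊢k

  original⇒collapsed : ConditionS M → ConditionS M'
  original⇒collapsed (k₀ , h , l , down-arcs , up-arcs , present , strict-arcs) =
    k₀ , h ∘ b , l ∘ b , thread⇒collapsed down down-arcs , thread⇒collapsed up up-arcs ,
    (λ t k₀≤t → inv⊢⇒collapsed-present (present⇒inv⊢ (present (b t) (ℕP.≤-trans k₀≤t (t≤b t))))) ,
    Sum.map (strict⇒collapsed down down-arcs) (strict⇒collapsed up up-arcs) strict-arcs

  module Shifted (k₀ : ℕ) where

    locate : ∀ k → b k₀ ≤ k → Σ ℕ λ u → b (u + k₀) ≤ k × k < b (suc (u + k₀))
    locate k bk₀≤k =
      segmentIndex k ∸ k₀ , subst (λ t → b t ≤ k) (sym shift) lo , subst (λ t → k < b (suc t)) (sym shift) hi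
      where
        shift = ℕP.m∸n+n≡m (segmentIndex-≥ k₀ k bk₀≤k)
        lo = proj₁ (segmentIndex-bounds k)
        hi = proj₂ (segmentIndex-bounds k)

    segmentIndex-shifted : ∀ u k → b (u + k₀) ≤ k → k < b (suc (u + k₀)) → segmentIndex k ∸ k₀ ≡ u
    segmentIndex-shifted u k lo hi = trans (cong (_∸ k₀) (segmentIndex-unique (u + k₀) k lo hi)) (ℕP.m+n∸n≡m u k₀)

    unshift : ∀ {t} → k₀ ≤ t → Σ ℕ λ u → u + k₀ ≡ t
    unshift k₀≤t = _ , ℕP.m∸n+n≡m k₀≤t

  module Lift (d : Direction) (k₀ : ℕ) (h' : ℕ → Fin n) (arcs' : IsThread M' d k₀ h') where
    open Shifted k₀

    Selection : ℕ → Set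
    Selection u = Σ Strictness λ f →
        ThreadSegment d f (b (u + k₀)) (b (suc (u + k₀))) (h' (u + k₀)) (h' (suc (u + k₀)))
      × (M' (u + k₀) (threadArc d strict (h' (u + k₀)) (h' (suc (u + k₀)))) → f ≡ strict)

    select : ∀ u → Selection u
    select u with oriented? d (path? strict) (b (u + k₀) , h' (u + k₀)) (b (suc (u + k₀)) , h' (suc (u + k₀)))
    ... | yes π = strict , path⇒segment d π (b-increasing _) , λ _ → refl
    ... | no ¬π = weak
                , path⇒segment d (collapse⇒threadPath d (b-increasing _) (arcs' (u + k₀) (ℕP.m≤n+m k₀ u))) (b-increasing _)
                , λ ⊢s → ⊥-elim (¬π (collapse⇒threadPath d (b-increasing _) ⊢s))

    selected : ∀ u
      → ThreadSegment d (proj₁ (select u)) (b (u + k₀)) (b (suc (u + k₀))) (h' (u + k₀)) (h' (suc (u + k₀)))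
    selected u = proj₁ (proj₂ (select u))

    thread : ℕ → Fin n
    thread k = ThreadSegment.thread (selected (segmentIndex k ∸ k₀)) k

    thread-agrees : ∀ u k → b (u + k₀) ≤ k → k ≤ b (suc (u + k₀)) → thread k ≡ ThreadSegment.thread (selected u) k
    thread-agrees u k lo hi with ℕP.m≤n⇒m<n∨m≡n hi
    ... | inj₁ k<b  = cong (λ v → ThreadSegment.thread (selected v) k) (segmentIndex-shifted u k lo k<b)
    ... | inj₂ refl =
      trans (cong (λ v → ThreadSegment.thread (selected v) k) (segmentIndex-shifted (suc u) k ℕP.≤-refl (b-increasing _)))
            (trans (ThreadSegment.thread-start (selected (suc u))) (sym (ThreadSegment.thread-end (selected u))))

    lift-arc : ∀ {f} u k → b (u + k₀) ≤ k → k < b (suc (u + k₀))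
      → Step⊢ k (threadArc d f (ThreadSegment.thread (selected u) k) (ThreadSegment.thread (selected u) (suc k)))
      → M k (threadArc d f (thread k) (thread (suc k)))
    lift-arc u k lo hi ⊢c = step⊢⇒multipath
      (arc-cong (sym (thread-agrees u k lo (ℕP.<⇒≤ hi))) (sym (thread-agrees u (suc k) (ℕP.m≤n⇒m≤1+n lo) hi)) ⊢c)

    is-thread : IsThread M d (b k₀) thread
    is-thread k bk₀≤k = let u , lo , hi = locate k bk₀≤k in lift-arc u k lo hi (ThreadSegment.arcs (selected u) k lo hi)

    infinitely-strict : InfinitelyStrict M' d k₀ h' → InfinitelyStrict M d (b k₀) thread
    infinitely-strict strict' m with strict' m
    ... | t , m≤t , k₀≤t , ⊢s with unshift k₀≤t
    ... | u , refl =
      let k , lo , hi , ⊢k = ThreadSegment.strict-arc (selected u) (proj₂ (proj₂ (select u)) ⊢s)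
      in k , ℕP.≤-trans m≤t (ℕP.≤-trans (t≤b _) lo) , ℕP.≤-trans (b-mono (ℕP.m≤n+m k₀ u)) lo , lift-arc u k lo hi ⊢k

    path-to-end : ∀ u k → b (u + k₀) ≤ k → k < b (suc (u + k₀))
                → oriented d (Path weak) (k , thread k) (b (suc (u + k₀)) , h' (suc (u + k₀)))
    path-to-end u k lo hi = subst (λ v → oriented d (Path weak) (k , v) _) (sym (thread-agrees u k lo (ℕP.<⇒≤ hi)))
                                  (segment⇒path (selected u) lo (ℕP.<⇒≤ hi))

  collapsed⇒original : ConditionS M' → ConditionS M
  collapsed⇒original (k₀ , h' , l' , down-arcs , up-arcs , present' , strict-arcs) =
    b k₀ , D.thread , U.thread , D.is-thread , U.is-thread , present ,
    Sum.map D.infinitely-strict U.infinitely-strict strict-arcs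
    where
      module D = Lift down k₀ h' down-arcs
      module U = Lift up k₀ l' up-arcs
      -- Down to the end of the segment, across by the collapsed present constraint, and back up:
      -- a path within one time, hence an invariant.
      present : ∀ k → b k₀ ≤ k → PresentAt M k (D.thread k) ge (U.thread k)
      present k bk₀≤k =
        let u , lo , hi = Shifted.locate k₀ k bk₀≤k in
        inv⊢⇒present (level-path⇒inv⊢ (D.path-to-end u k lo hi
          ++ᵖ collapsed-present⇒path (present' (suc (u + k₀)) (ℕP.m≤n⇒m≤1+n (ℕP.m≤n+m k₀ u)))
          ++ᵖ U.path-to-end u k lo hi))

mainTheorem10 : ∀ {n} (S : MCS n) → Stable S → (p : InfPath S)
    → (b : ℕ → ℕ) → b 0 ≡ 0 → (∀ t → b t < b (suc t))
    → (ConditionS (collapsedMultipath S p b) → ConditionS (multipath S p))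
    × (ConditionS (multipath S p) → ConditionS (collapsedMultipath S p b))
mainTheorem10 S stable p b b0≡0 b-increasing = collapsed⇒original , original⇒collapsed
  where open CollapseTheorem S stable p b b0≡0 b-increasing
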